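{- For any formula $\phi_0\in\Phi$: if $w\Vdash\phi_0$ for every epistemic world $w\in W$ of every Kripke model with evidence $\langle W,E,\{\sim_e\}_{e\in E},\pi\rangle$, then $\vdash\phi_0$.
   Context: Fix an infinite set of propositional variables. The set $\Phi$ of formulae is given by $\phi ::= p \mid \neg\phi \mid \phi\to\phi \mid \boxdot\phi \mid \Box\phi$, where $p$ ranges over propositional variables. The logical system consists of all propositional tautologies in the language $\Phi$ together with the axioms (for all formulae $\phi,\psi$): Truth $\Box\phi\to\phi$; Negative Introspection $\neg\Box\phi\to\Box\neg\Box\phi$; Distributivity $\Box(\phi\to\psi)\to(\Box\phi\to\Box\psi)$; Monotonicity $\boxdot\phi\to\Box\phi$; Attainable Positive Introspection $\boxdot\phi\to\boxdot\boxdot\phi$; Attainable Distributivity $\boxdot(\phi\to\psi)\to(\boxdot\phi\to\boxdot\psi)$. The inference rules are Modus Ponens (from $\phi$ and $\phi\to\psi$ infer $\psi$) and Attainable Necessitation (from $\phi$ infer $\boxdot\phi$). We write $\vdash\phi$ if $\phi$ is derivable from the axioms using these two rules. A Kripke model with evidence is a tuple $\langle W,E,\{\sim_e\}_{e\in E},\pi\rangle$ where $W$ is a set (of epistemic worlds), $E$ is an arbitrary set (of evidence), each $\sim_e$ is an equivalence relation on $W$, and $\pi$ maps propositional variables to subsets of $W$. For $F\subseteq E$ write $w\sim_F u$ if $w\sim_e u$ for all $e\in F$. Satisfaction is defined by: $w\Vdash p$ iff $w\in\pi(p)$; $w\Vdash\neg\phi$ iff $w\nVdash\phi$; $w\Vdash\phi\to\psi$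 iff $w\nVdash\phi$ or $w\Vdash\psi$; $w\Vdash\boxdot\phi$ iff there is a finite $F\subseteq E$ such that $u\Vdash\phi$ for every $u\in W$ with $w\sim_F u$; $w\Vdash\Box\phi$ iff $u\Vdash\phi$ for every $u\in W$ with $w\sim_E u$. -}

module Defs where

open import Data.Nat using (ℕ)
open import Data.Bool using (Bool; true; false; not; _∨_)
open import Data.List using (List)
open import Data.List.Membership.Propositional using (_∈_)
open import Data.Product using (Σ)
open import Data.Sum using (_⊎_)
open import Relation.Nullary using (¬_)
open import Relation.Binary.PropositionalEquality using (_≡_)
open import Relation.Binary.Structures using (IsEquivalence)

data Fm : Set where
  var : ℕ → Fm
  ~_  : Fm → Fm
  _⇒_ : Fm → Fm → Fm
  ⊡_  : Fm → Fm
  □_  : Fm → Fm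

infixr 5 _⇒_
infix 6 ~_ ⊡_ □_

-- Propositional tautologies of the language Φ: formulas true under every
-- Boolean valuation of their propositional "atoms", where the atoms are
-- the propositional variables and the modal formulas ⊡φ, □φ.
eval : (Fm → Bool) → Fm → Bool
eval V (var p) = V (var p)
eval V (~ φ)   = not (eval V φ)
eval V (φ ⇒ ψ) = not (eval V φ) ∨ eval V ψ
eval V (⊡ φ)   = V (⊡ φ)
eval V (□ φ)   = V (□ φ)

Tautology : Fm → Set
Tautology φ = ∀ (V : Fm → Bool) → eval V φ ≡ true

data ⊢_ : Fm → Set where
  taut   : ∀ {φ} → Tautology φ → ⊢ φ
  truth  : ∀ {φ} → ⊢ (□ φ ⇒ φ)
  negint : ∀ {φ} → ⊢ (~ □ φ ⇒ □ ~ □ φ)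
  dist   : ∀ {φ ψ} → ⊢ (□ (φ ⇒ ψ) ⇒ (□ φ ⇒ □ ψ))
  mono   : ∀ {φ} → ⊢ (⊡ φ ⇒ □ φ)
  apos   : ∀ {φ} → ⊢ (⊡ φ ⇒ ⊡ ⊡ φ)
  adist  : ∀ {φ ψ} → ⊢ (⊡ (φ ⇒ ψ) ⇒ (⊡ φ ⇒ ⊡ ψ))
  mp     : ∀ {φ ψ} → ⊢ φ → ⊢ (φ ⇒ ψ) → ⊢ ψ
  anec   : ∀ {φ} → ⊢ φ → ⊢ (⊡ φ)

infix 3 ⊢_

record Model : Set₁ where
  field
    W   : Set
    E   : Set
    R   : E → W → W → Set
    equiv : ∀ e → IsEquivalence (R e)
    π   : ℕ → W → Set

  -- w ∼_F u for a finite F ⊆ E (represented by a list)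
  RF : List E → W → W → Set
  RF F w u = ∀ e → e ∈ F → R e w u

  RE : W → W → Set
  RE w u = ∀ e → R e w u

  _⊩_ : W → Fm → Set
  w ⊩ var p   = π p w
  w ⊩ (~ φ)   = ¬ (w ⊩ φ)
  w ⊩ (φ ⇒ ψ) = (¬ (w ⊩ φ)) ⊎ (w ⊩ ψ)
  w ⊩ (⊡ φ)   = Σ (List E) λ F → ∀ u → RF F w u → u ⊩ φ
  w ⊩ (□ φ)   = ∀ u → RE w u → u ⊩ φ

open Model public

Valid : Fm → Set₁
Valid φ = ∀ (M : Model) (w : W M) → _⊩_ M w φ

-- Completeness via a finite canonical model. Truth assignments to the atoms of φ₀ (its variables
-- and modal subformulas) are each described by a formula χ A. Starting from all of them, we keep
-- discarding assignments that violate ⊡θ → θ or □θ → θ, or that make some ⊡θ (□θ) false without a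
-- remaining witness B, with θ false, that keeps all true ⊡-atoms (all modal atoms) of A. Each
-- discarded A is refuted, ⊢ ¬ χ A: the formula δ A (σ A) describing the admissible witnesses is
-- provably ⊡-stable (□-stable) and, by the pruning, implies θ. The survivors are unravelled into a
-- model with evidence ℕ whose points are chains of survivors along which true ⊡-atoms persist; as
-- finite evidence only sees a finite prefix of a chain, ⊡ and □ match the survivors' ⊡- and □-atoms.

module Submission where

open import Defs
open import Data.Nat using (ℕ; zero; suc; _<_; _≤_; _<ᵇ_; s≤s)
open import Data.List.Extrema.Nat using (max; xs≤max)
import Data.Nat.Properties as ℕ
open import Data.Bool using (Bool; true; false; not; _∨_; if_then_else_)
open import Data.Bool.Properties using (¬-not) renaming (_≟_ to _≟ᵇ_)
open import Data.List
  using (List; []; _∷_; _++_; [_]; foldr; length; map; filter; takeWhileᵇ; cartesianProductWith)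
open import Data.List.Properties using (length-map; filter-notAll)
open import Data.List.Membership.Propositional using (_∈_; find; lose)
open import Data.List.Membership.Propositional.Properties
  using (∈-++⁺ˡ; ∈-++⁺ʳ; ∈-++⁻; ∈-cartesianProductWith⁺; ∈-filter⁺; ∈-filter⁻)
open import Data.List.Relation.Binary.Subset.Propositional using (_⊆_)
open import Data.List.Relation.Unary.All as All using (All; []; _∷_; all?)
open import Data.List.Relation.Unary.All.Properties using (map⁺; map⁻; ¬All⇒Any¬; ++⁻ˡ; ++⁻ʳ)
open import Data.List.Relation.Binary.Pointwise as Pointwise using (Pointwise; []; _∷_)
open import Data.Product.Relation.Binary.Pointwise.NonDependent
  using (×-isEquivalence) renaming (Pointwise to ×-Pointwise)
open import Data.List.Relation.Unary.Any using (Any; here; there; any?)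
open import Data.Product using (Σ-syntax; _×_; _,_; proj₁; proj₂)
open import Data.Sum using (_⊎_; inj₁; inj₂; [_,_]′)
open import Data.Empty using (⊥-elim)
open import Data.Unit using (⊤; tt)
open import Function using (id; _∘′_; case_of_; _on_; _⇔_; mk⇔)
open import Function.Bundles using (module Equivalence)
open Equivalence using (to; from)
open import Relation.Nullary using (¬_; ¬?; Dec; yes; no; does; _×-dec_; _⊎-dec_; _→-dec_)
open import Relation.Nullary.Decidable using (map′; decidable-stable)
open import Relation.Nullary.Negation using (contradiction)
open import Relation.Unary using (Decidable)
open import Relation.Binary.Definitions using (DecidableEquality)
open import Relation.Binary.Structures using (IsEquivalence)
import Relation.Binary.Construct.On as On
open import Relation.Binary.PropositionalEquality
  using (_≡_; refl; sym; trans; subst; subst₂; cong; cong₂; module ≡-Reasoning)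
import Relation.Binary.PropositionalEquality as ≡

infix 4 _⊨_ _⊨?_

record _⊨_ (V : Fm → Bool) (φ : Fm) : Set where
  constructor sat
  field eval≡true : eval V φ ≡ true
open _⊨_ public

_⊨?_ : ∀ V φ → Dec (V ⊨ φ)
V ⊨? φ = map′ sat eval≡true (eval V φ ≟ᵇ true)

module _ {V : Fm → Bool} {a b : Fm} where

  ⊨⇒-intro : (V ⊨ a → V ⊨ b) → V ⊨ a ⇒ b
  ⊨⇒-intro f = sat (by-cases (eval V a) refl)
    where
    by-cases : ∀ x → eval V a ≡ x → not x ∨ eval V b ≡ true
    by-cases false _  = refl
    by-cases true  ea = eval≡true (f (sat ea))

  ⊨⇒-elim : V ⊨ a ⇒ b → V ⊨ a → V ⊨ b
  ⊨⇒-elim (sat h) (sat ha) = sat (subst (λ x → not x ∨ eval V b ≡ true) ha h)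

module _ {V : Fm → Bool} {a : Fm} where

  ⊨~-intro : ¬ V ⊨ a → V ⊨ ~ a
  ⊨~-intro f = sat (cong not (¬-not (λ e → f (sat e))))

  ⊨~-elim : V ⊨ ~ a → ¬ V ⊨ a
  ⊨~-elim (sat h) (sat ha) with subst (λ x → not x ≡ true) ha h
  ... | ()

  ⊨-stable : ¬ ¬ V ⊨ a → V ⊨ a
  ⊨-stable = decidable-stable (V ⊨? a)

⊢-consequence : ∀ {Γ φ} → All ⊢_ Γ → (∀ V → All (V ⊨_) Γ → V ⊨ φ) → ⊢ φ
⊢-consequence []       h = taut (λ V → eval≡true (h V []))
⊢-consequence (d ∷ ds) h = mp d (⊢-consequence ds λ V hs → ⊨⇒-intro λ ha → h V (ha ∷ hs))

⊢-taut⇒ : ∀ {a b} → (∀ {V} → V ⊨ a → V ⊨ b) → ⊢ a ⇒ b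
⊢-taut⇒ h = taut (λ V → eval≡true (⊨⇒-intro h))

⊢-syl : ∀ {a b c} → ⊢ a ⇒ b → ⊢ b ⇒ c → ⊢ a ⇒ c
⊢-syl d e = ⊢-consequence (d ∷ e ∷ []) λ { V (h ∷ k ∷ []) →
  ⊨⇒-intro (λ ha → ⊨⇒-elim k (⊨⇒-elim h ha)) }

⊢-contrapose : ∀ {a b} → ⊢ a ⇒ b → ⊢ ~ b ⇒ ~ a
⊢-contrapose d = ⊢-consequence (d ∷ []) λ { V (h ∷ []) →
  ⊨⇒-intro (λ hb → ⊨~-intro (λ ha → ⊨~-elim hb (⊨⇒-elim h ha))) }

⊢-refute : ∀ {a b} → ⊢ a ⇒ b → ⊢ a ⇒ ~ b → ⊢ ~ a
⊢-refute d e = ⊢-consequence (d ∷ e ∷ []) λ { V (h ∷ k ∷ []) →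
  ⊨~-intro (λ ha → ⊨~-elim (⊨⇒-elim k ha) (⊨⇒-elim h ha)) }

⊢-explode : ∀ {a b} → ⊢ ~ a → ⊢ a ⇒ b
⊢-explode d = ⊢-consequence (d ∷ []) λ { V (h ∷ []) →
  ⊨⇒-intro (λ ha → ⊥-elim (⊨~-elim h ha)) }

⊢-weaken : ∀ {a b} → ⊢ b → ⊢ a ⇒ b
⊢-weaken d = ⊢-consequence (d ∷ []) λ { V (h ∷ []) → ⊨⇒-intro (λ _ → h) }

infixr 6 _&_

_&_ : Fm → Fm → Fm
a & b = ~ (a ⇒ ~ b)

⋀ : Fm → List Fm → Fm
⋀ u = foldr _&_ u

module _ {V : Fm → Bool} {a b : Fm} where

  ⊨&⁺ : V ⊨ a → V ⊨ b → V ⊨ a & b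
  ⊨&⁺ ha hb = ⊨~-intro (λ h → ⊨~-elim (⊨⇒-elim h ha) hb)

  ⊨&⁻ : V ⊨ a & b → V ⊨ a × V ⊨ b
  ⊨&⁻ h = ⊨-stable (λ ¬a → ⊨~-elim h (⊨⇒-intro (λ ha → ⊥-elim (¬a ha))))
        , ⊨-stable (λ ¬b → ⊨~-elim h (⊨⇒-intro (λ _ → ⊨~-intro ¬b)))

module _ {V : Fm → Bool} {u : Fm} where

  ⊨⋀⁺ : ∀ {xs} → V ⊨ u → All (V ⊨_) xs → V ⊨ ⋀ u xs
  ⊨⋀⁺ hu []       = hu
  ⊨⋀⁺ hu (h ∷ hs) = ⊨&⁺ h (⊨⋀⁺ hu hs)

  ⊨⋀⁻ : ∀ {xs} → V ⊨ ⋀ u xs → All (V ⊨_) xs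
  ⊨⋀⁻ {[]}     _ = []
  ⊨⋀⁻ {x ∷ xs} h = let hx , hxs = ⊨&⁻ h in hx ∷ ⊨⋀⁻ hxs

module NormalModality (M : Fm → Fm)
  (nec : ∀ {a} → ⊢ a → ⊢ M a)
  (K : ∀ {a b} → ⊢ M (a ⇒ b) ⇒ M a ⇒ M b) where

  monotonic : ∀ {a b} → ⊢ a ⇒ b → ⊢ M a ⇒ M b
  monotonic d = mp (nec d) K

  stable-& : ∀ {a b} → ⊢ a ⇒ M a → ⊢ b ⇒ M b → ⊢ a & b ⇒ M (a & b)
  stable-& {a} {b} da db = ⊢-consequence (da ∷ db ∷ monotonic pair ∷ K ∷ [])
    λ { V (ha ∷ hb ∷ hpair ∷ hK ∷ []) → ⊨⇒-intro λ h → let h₁ , h₂ = ⊨&⁻ h in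
        ⊨⇒-elim (⊨⇒-elim hK (⊨⇒-elim hpair (⊨⇒-elim ha h₁))) (⊨⇒-elim hb h₂) }
    where
    pair : ⊢ a ⇒ b ⇒ a & b
    pair = ⊢-taut⇒ (λ ha → ⊨⇒-intro (λ hb → ⊨&⁺ ha hb))

  stable-⋀ : ∀ {u xs} → ⊢ u → All (λ x → ⊢ x ⇒ M x) xs → ⊢ ⋀ u xs ⇒ M (⋀ u xs)
  stable-⋀ du []       = ⊢-weaken (nec du)
  stable-⋀ du (d ∷ ds) = stable-& d (stable-⋀ du ds)

□-nec : ∀ {a} → ⊢ a → ⊢ □ a
□-nec d = mp (anec d) mono

open NormalModality □_ □-nec dist public
  renaming (monotonic to □-mono; stable-⋀ to □-stable-⋀) using ()
open NormalModality ⊡_ anec adist public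
  renaming (monotonic to ⊡-mono; stable-⋀ to ⊡-stable-⋀) using ()

□-4 : ∀ {a} → ⊢ □ a ⇒ □ □ a
□-4 {a} = ⊢-syl ◇-intro (⊢-syl negint (□-mono ◇□-elim))
  where
  ◇-intro : ⊢ □ a ⇒ ~ □ ~ □ a
  ◇-intro = ⊢-syl (⊢-taut⇒ λ h → ⊨~-intro (λ h' → ⊨~-elim h' h)) (⊢-contrapose truth)
  ◇□-elim : ⊢ ~ □ ~ □ a ⇒ □ a
  ◇□-elim = ⊢-syl (⊢-contrapose negint) (⊢-taut⇒ λ h → ⊨-stable (⊨~-elim h ∘′ ⊨~-intro))

⊡-T : ∀ {a} → ⊢ ⊡ a ⇒ a
⊡-T = ⊢-syl mono truth

⊡⇒□⊡ : ∀ {a} → ⊢ ⊡ a ⇒ □ ⊡ a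
⊡⇒□⊡ = ⊢-syl apos mono

~⊡⇒□~⊡ : ∀ {a} → ⊢ ~ ⊡ a ⇒ □ ~ ⊡ a
~⊡⇒□~⊡ = ⊢-syl (⊢-contrapose truth) (⊢-syl negint (□-mono (⊢-contrapose ⊡⇒□⊡)))

infix 4 _≟_

_≟_ : DecidableEquality Fm
var p   ≟ var q   = map′ (cong var) (λ { refl → refl }) (p ℕ.≟ q)
(~ a)   ≟ (~ b)   = map′ (cong ~_) (λ { refl → refl }) (a ≟ b)
(a ⇒ b) ≟ (c ⇒ d) = map′ (λ (e , e′) → cong₂ _⇒_ e e′) (λ { refl → refl , refl }) (a ≟ c ×-dec b ≟ d)
(⊡ a)   ≟ (⊡ b)   = map′ (cong ⊡_) (λ { refl → refl }) (a ≟ b)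
(□ a)   ≟ (□ b)   = map′ (cong □_) (λ { refl → refl }) (a ≟ b)
var _   ≟ ~ _     = no λ ()
var _   ≟ _ ⇒ _   = no λ ()
var _   ≟ ⊡ _     = no λ ()
var _   ≟ □ _     = no λ ()
~ _     ≟ var _   = no λ ()
~ _     ≟ _ ⇒ _   = no λ ()
~ _     ≟ ⊡ _     = no λ ()
~ _     ≟ □ _     = no λ ()
_ ⇒ _   ≟ var _   = no λ ()
_ ⇒ _   ≟ ~ _     = no λ ()
_ ⇒ _   ≟ ⊡ _     = no λ ()
_ ⇒ _   ≟ □ _     = no λ ()
⊡ _     ≟ var _   = no λ ()
⊡ _     ≟ ~ _     = no λ ()
⊡ _     ≟ _ ⇒ _   = no λ ()
⊡ _     ≟ □ _     = no λ ()
□ _     ≟ var _   = no λ ()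
□ _     ≟ ~ _     = no λ ()
□ _     ≟ _ ⇒ _   = no λ ()
□ _     ≟ ⊡ _     = no λ ()

atoms : Fm → List Fm
atoms (var p) = [ var p ]
atoms (~ φ)   = atoms φ
atoms (φ ⇒ ψ) = atoms φ ++ atoms ψ
atoms (⊡ φ)   = ⊡ φ ∷ atoms φ
atoms (□ φ)   = □ φ ∷ atoms φ

eval-atom : ∀ V φ {a} → a ∈ atoms φ → eval V a ≡ V a
eval-atom V (var p) (here refl) = refl
eval-atom V (~ φ)   m           = eval-atom V φ m
eval-atom V (φ ⇒ ψ) m           = [ eval-atom V φ , eval-atom V ψ ]′ (∈-++⁻ (atoms φ) m)
eval-atom V (⊡ φ)   (here refl) = refl
eval-atom V (⊡ φ)   (there m)   = eval-atom V φ m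
eval-atom V (□ φ)   (here refl) = refl
eval-atom V (□ φ)   (there m)   = eval-atom V φ m

atoms-⊆ : ∀ φ {a} → a ∈ atoms φ → atoms a ⊆ atoms φ
atoms-⊆ (var p) (here refl) = id
atoms-⊆ (~ φ)   m           = atoms-⊆ φ m
atoms-⊆ (φ ⇒ ψ) m with ∈-++⁻ (atoms φ) m
... | inj₁ m′ = ∈-++⁺ˡ ∘′ atoms-⊆ φ m′
... | inj₂ m′ = ∈-++⁺ʳ (atoms φ) ∘′ atoms-⊆ ψ m′
atoms-⊆ (⊡ φ)   (here refl) = id
atoms-⊆ (⊡ φ)   (there m)   = there ∘′ atoms-⊆ φ m
atoms-⊆ (□ φ)   (here refl) = id
atoms-⊆ (□ φ)   (there m)   = there ∘′ atoms-⊆ φ m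

eval-cong : ∀ φ {V V′} → (∀ {a} → a ∈ atoms φ → eval V a ≡ eval V′ a) → eval V φ ≡ eval V′ φ
eval-cong (var p) h = h (here refl)
eval-cong (~ φ)   h = cong not (eval-cong φ h)
eval-cong (φ ⇒ ψ) h =
  cong₂ (λ x y → not x ∨ y) (eval-cong φ (h ∘′ ∈-++⁺ˡ)) (eval-cong ψ (h ∘′ ∈-++⁺ʳ (atoms φ)))
eval-cong (⊡ φ)   h = h (here refl)
eval-cong (□ φ)   h = h (here refl)

data Modal : Fm → Set where
  ⊡ᵐ : ∀ θ → Modal (⊡ θ)
  □ᵐ : ∀ θ → Modal (□ θ)

data Dotted : Fm → Set where
  ⊡ᵈ : ∀ θ → Dotted (⊡ θ)

modal? : Decidable Modal
modal? (var _) = no λ ()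
modal? (~ _)   = no λ ()
modal? (_ ⇒ _) = no λ ()
modal? (⊡ θ)   = yes (⊡ᵐ θ)
modal? (□ θ)   = yes (□ᵐ θ)

dotted? : Decidable Dotted
dotted? (var _) = no λ ()
dotted? (~ _)   = no λ ()
dotted? (_ ⇒ _) = no λ ()
dotted? (⊡ θ)   = yes (⊡ᵈ θ)
dotted? (□ _)   = no λ ()

Dotted⇒Modal : ∀ {a} → Dotted a → Modal a
Dotted⇒Modal (⊡ᵈ θ) = ⊡ᵐ θ

∈-bools : ∀ b → b ∈ true ∷ false ∷ []
∈-bools true  = here refl
∈-bools false = there (here refl)

boolLists : ℕ → List (List Bool)
boolLists zero    = [ [] ]
boolLists (suc n) = cartesianProductWith _∷_ (true ∷ false ∷ []) (boolLists n)

∈-boolLists : ∀ bs → bs ∈ boolLists (length bs)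
∈-boolLists []       = here refl
∈-boolLists (b ∷ bs) = ∈-cartesianProductWith⁺ _∷_ (∈-bools b) (∈-boolLists bs)

lookupᵛ : List Fm → List Bool → Fm → Bool
lookupᵛ (b ∷ bs) (x ∷ xs) a = if does (b ≟ a) then x else lookupᵛ bs xs a
lookupᵛ _        _        _ = false

lookupᵛ-map : ∀ V bs {a} → a ∈ bs → lookupᵛ bs (map V bs) a ≡ V a
lookupᵛ-map V (b ∷ bs) {a} m with b ≟ a | m
... | yes refl | _         = refl
... | no b≢a   | here refl = contradiction refl b≢a
... | no _     | there m′  = lookupᵛ-map V bs m′

lit : Bool → Fm → Fm
lit true  a = a
lit false a = ~ a

lit-⊨ : ∀ {V a b} → eval V a ≡ b → V ⊨ lit b a
lit-⊨ {b = true}  e = sat e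
lit-⊨ {b = false} e = ⊨~-intro (λ (sat e′) → case trans (sym e) e′ of λ ())

⊨-lit : ∀ {V a} b → V ⊨ lit b a → eval V a ≡ b
⊨-lit true  (sat e) = e
⊨-lit false h       = ¬-not (λ e → ⊨~-elim h (sat e))

module Completeness (φ₀ : Fm) where

  base : List Fm
  base = atoms φ₀

  InBase : Fm → Set
  InBase ψ = atoms ψ ⊆ base

  InBase-⇒ : ∀ a b → InBase a → InBase b → InBase (a ⇒ b)
  InBase-⇒ a _ ia ib m = [ ia , ib ]′ (∈-++⁻ (atoms a) m)

  InBase-atom : ∀ {a} → a ∈ base → InBase a
  InBase-atom = atoms-⊆ φ₀

  InBase-lit : ∀ b a → InBase a → InBase (lit b a)
  InBase-lit true  _ i = i
  InBase-lit false _ i = i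

  -- A tautology whose atoms lie in `base`.
  ⊤ᶠ : Fm
  ⊤ᶠ = φ₀ ⇒ φ₀

  ⊨⊤ : ∀ {V} → V ⊨ ⊤ᶠ
  ⊨⊤ = ⊨⇒-intro id

  ⊢⊤ : ⊢ ⊤ᶠ
  ⊢⊤ = taut (λ _ → eval≡true ⊨⊤)

  InBase-⋀ : ∀ {xs} → All InBase xs → InBase (⋀ ⊤ᶠ xs)
  InBase-⋀ {[]}     []       = InBase-⇒ φ₀ φ₀ id id
  InBase-⋀ {x ∷ xs} (i ∷ is) = InBase-⇒ x (~ ⋀ ⊤ᶠ xs) i (InBase-⋀ is)

  -- An assignment lists truth values for the formulas of `base`, in order; `val` looks them up.
  Assignment : Set
  Assignment = List Bool

  val : Assignment → Fm → Bool
  val = lookupᵛ base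

  allAssignments : List Assignment
  allAssignments = boolLists (length base)

  assignmentOf : (Fm → Bool) → Assignment
  assignmentOf V = map V base

  assignmentOf∈all : ∀ V → assignmentOf V ∈ allAssignments
  assignmentOf∈all V =
    subst (λ n → assignmentOf V ∈ boolLists n) (length-map V base) (∈-boolLists (assignmentOf V))

  literal : Assignment → Fm → Fm
  literal A a = lit (eval (val A) a) a

  χ : Assignment → Fm
  χ A = ⋀ ⊤ᶠ (map (literal A) base)

  χ-determines : ∀ {V A} ψ → V ⊨ χ A → InBase ψ → eval V ψ ≡ eval (val A) ψ
  χ-determines ψ h i = eval-cong ψ (λ m → ⊨-lit _ (All.lookup (map⁻ (⊨⋀⁻ h)) (i m)))

  ⊨χ-assignmentOf : ∀ {V} → V ⊨ χ (assignmentOf V)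
  ⊨χ-assignmentOf {V} = ⊨⋀⁺ ⊨⊤ (map⁺ (All.tabulate λ m → lit-⊨ (agree m)))
    where
    open ≡-Reasoning
    agree : ∀ {a} → a ∈ base → eval V a ≡ eval (val (assignmentOf V)) a
    agree {a} m = begin
      eval V a                 ≡⟨ eval-atom V φ₀ m ⟩
      V a                      ≡⟨ lookupᵛ-map V base m ⟨
      val (assignmentOf V) a         ≡⟨ eval-atom (val (assignmentOf V)) φ₀ m ⟨
      eval (val (assignmentOf V)) a  ∎

  χ⇒ : ∀ {A} ψ → InBase ψ → val A ⊨ ψ → ⊢ χ A ⇒ ψ
  χ⇒ ψ i (sat h) = ⊢-taut⇒ λ hχ → sat (trans (χ-determines ψ hχ i) h)

  -- Every valuation satisfies χ of its own restriction to `base`.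
  ⊢-by-assignments : ∀ {ψ} → (∀ {B} → B ∈ allAssignments → ⊢ χ B ⇒ ψ) → ⊢ ψ
  ⊢-by-assignments d = ⊢-consequence (map⁺ (All.tabulate d)) λ V hs →
    ⊨⇒-elim (All.lookup (map⁻ hs) (assignmentOf∈all V)) ⊨χ-assignmentOf

  Refuted : Assignment → Set
  Refuted A = ⊢ ~ χ A

  Covers : List Assignment → Set
  Covers S = ∀ {B} → B ∈ allAssignments → B ∈ S ⊎ Refuted B

  ⊢-by-cover : ∀ {S ψ} → Covers S → InBase ψ → (∀ {B} → B ∈ S → val B ⊨ ψ) → ⊢ ψ
  ⊢-by-cover cov i h = ⊢-by-assignments λ m → [ (λ B∈S → χ⇒ _ i (h B∈S)) , ⊢-explode ]′ (cov m)

  Leq : Assignment → Assignment → Set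
  Leq A B = All (λ a → Dotted a → val A ⊨ a → val B ⊨ a) base

  Eqv : Assignment → Assignment → Set
  Eqv A B = All (λ a → Modal a → eval (val A) a ≡ eval (val B) a) base

  leq? : ∀ A B → Dec (Leq A B)
  leq? A B = all? (λ a → dotted? a →-dec val A ⊨? a →-dec val B ⊨? a) base

  eqv? : ∀ A B → Dec (Eqv A B)
  eqv? A B = all? (λ a → modal? a →-dec eval (val A) a ≟ᵇ eval (val B) a) base

  Leq-refl : ∀ {A} → Leq A A
  Leq-refl = All.universal (λ _ _ h → h) base

  Leq-trans : ∀ {A B C} → Leq A B → Leq B C → Leq A C
  Leq-trans l l′ = All.zipWith (λ (f , g) d → g d ∘′ f d) (l , l′)

  Eqv-isEquivalence : IsEquivalence Eqv
  Eqv-isEquivalence = record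
    { refl  = All.universal (λ _ _ → refl) base
    ; sym   = All.map (λ e m → sym (e m))
    ; trans = λ e e′ → All.zipWith (λ (f , g) m → trans (f m) (g m)) (e , e′)
    }

  open IsEquivalence Eqv-isEquivalence public using () renaming (refl to Eqv-refl)

  Eqv-⊨ : ∀ {A B a} → Eqv A B → a ∈ base → Modal a → val A ⊨ a → val B ⊨ a
  Eqv-⊨ e m d (sat h) = sat (trans (sym (All.lookup e m d)) h)

  Eqv⇒Leq : ∀ {A B} → Eqv A B → Leq A B
  Eqv⇒Leq e = All.tabulate λ m d → Eqv-⊨ e m (Dotted⇒Modal d)

  dotTrue? : ∀ A → Decidable (λ a → Dotted a × val A ⊨ a)
  dotTrue? A a = dotted? a ×-dec val A ⊨? a

  trueDots : Assignment → List Fm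
  trueDots A = filter (dotTrue? A) base

  ∈-trueDots⁻ : ∀ A {a} → a ∈ trueDots A → a ∈ base × Dotted a × val A ⊨ a
  ∈-trueDots⁻ A = ∈-filter⁻ (dotTrue? A)

  modalBase : List Fm
  modalBase = filter modal? base

  ∈-modalBase⁻ : ∀ {a} → a ∈ modalBase → a ∈ base × Modal a
  ∈-modalBase⁻ = ∈-filter⁻ modal?

  δ : Assignment → Fm
  δ A = ⋀ ⊤ᶠ (trueDots A)

  σ : Assignment → Fm
  σ A = ⋀ ⊤ᶠ (map (literal A) modalBase)

  InBase-δ : ∀ A → InBase (δ A)
  InBase-δ A = InBase-⋀ (All.tabulate (InBase-atom ∘′ proj₁ ∘′ ∈-trueDots⁻ A))

  ⊨δ : ∀ {A} → val A ⊨ δ A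
  ⊨δ {A} = ⊨⋀⁺ ⊨⊤ (All.tabulate (proj₂ ∘′ proj₂ ∘′ ∈-trueDots⁻ A))

  δ-stable : ∀ {A} → ⊢ δ A ⇒ ⊡ δ A
  δ-stable {A} = ⊡-stable-⋀ ⊢⊤ (All.tabulate (stable ∘′ proj₁ ∘′ proj₂ ∘′ ∈-trueDots⁻ A))
    where
    stable : ∀ {a} → Dotted a → ⊢ a ⇒ ⊡ a
    stable (⊡ᵈ θ) = apos

  ⊨δ⇒Leq : ∀ {A B} → val B ⊨ δ A → Leq A B
  ⊨δ⇒Leq {A} h = All.tabulate λ m d hA → All.lookup (⊨⋀⁻ h) (∈-filter⁺ (dotTrue? A) m (d , hA))

  InBase-σ : ∀ A → InBase (σ A)
  InBase-σ A = InBase-⋀ (map⁺ (All.tabulate λ {a} m →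
    InBase-lit (eval (val A) a) a (InBase-atom (proj₁ (∈-modalBase⁻ m)))))

  ⊨σ : ∀ {A} → val A ⊨ σ A
  ⊨σ = ⊨⋀⁺ ⊨⊤ (map⁺ {xs = modalBase} (All.tabulate λ {a} _ → lit-⊨ {a = a} refl))

  σ-stable : ∀ {A} → ⊢ σ A ⇒ □ σ A
  σ-stable {A} = □-stable-⋀ ⊢⊤ (map⁺ {xs = modalBase} (All.tabulate (stable ∘′ proj₂ ∘′ ∈-modalBase⁻)))
    where
    stable : ∀ {a} → Modal a → ⊢ literal A a ⇒ □ literal A a
    stable (⊡ᵐ θ) with val A (⊡ θ)
    ... | true  = ⊡⇒□⊡
    ... | false = ~⊡⇒□~⊡
    stable (□ᵐ θ) with val A (□ θ)
    ... | true  = □-4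
    ... | false = negint

  ⊨σ⇒Eqv : ∀ {A B} → val B ⊨ σ A → Eqv A B
  ⊨σ⇒Eqv h = All.tabulate λ m d → sym (⊨-lit _ (All.lookup (map⁻ (⊨⋀⁻ h)) (∈-filter⁺ modal? m d)))

  Requirement : List Assignment → Assignment → Fm → Set
  Requirement S A (⊡ θ) = (val A ⊨ ⊡ θ → val A ⊨ θ)
                        × (val A ⊨ ⊡ θ ⊎ Any (λ B → Leq A B × ¬ val B ⊨ θ) S)
  Requirement S A (□ θ) = (val A ⊨ □ θ → val A ⊨ θ)
                        × (val A ⊨ □ θ ⊎ Any (λ B → Eqv A B × ¬ val B ⊨ θ) S)
  Requirement S A _     = ⊤

  requirement? : ∀ S A a → Dec (Requirement S A a)
  requirement? S A (var _) = yes tt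
  requirement? S A (~ _)   = yes tt
  requirement? S A (_ ⇒ _) = yes tt
  requirement? S A (⊡ θ)   = (val A ⊨? ⊡ θ →-dec val A ⊨? θ)
                       ×-dec (val A ⊨? ⊡ θ ⊎-dec any? (λ B → leq? A B ×-dec ¬? (val B ⊨? θ)) S)
  requirement? S A (□ θ)   = (val A ⊨? □ θ →-dec val A ⊨? θ)
                       ×-dec (val A ⊨? □ θ ⊎-dec any? (λ B → eqv? A B ×-dec ¬? (val B ⊨? θ)) S)

  Viable : List Assignment → Assignment → Set
  Viable S A = All (Requirement S A) base

  viable? : ∀ S A → Dec (Viable S A)
  viable? S A = all? (requirement? S A) base

  refute-reflexive : ∀ {A a θ} → ⊢ a ⇒ θ → InBase a → InBase θ → val A ⊨ a → ¬ val A ⊨ θ → Refuted A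
  refute-reflexive {a = a} {θ} d ia iθ h ¬h = ⊢-refute (⊢-syl (χ⇒ a ia h) d) (χ⇒ (~ θ) iθ (⊨~-intro ¬h))

  -- χ A ⊢ c ⊢ M c ⊢ M θ, while M θ is false at A.
  refute-stable : ∀ {A c θ} {M : Fm → Fm} → (∀ {a b} → ⊢ a ⇒ b → ⊢ M a ⇒ M b) →
                  InBase c → val A ⊨ c → ⊢ c ⇒ M c → ⊢ c ⇒ θ → InBase (M θ) → ¬ val A ⊨ M θ → Refuted A
  refute-stable {c = c} {θ} {M} M-mono ic hc stable cθ iMθ ¬Mθ =
    ⊢-refute (⊢-syl (χ⇒ c ic hc) (⊢-syl stable (M-mono cθ))) (χ⇒ (~ M θ) iMθ (⊨~-intro ¬Mθ))

  refuted-if-unmet : ∀ {S A a} → Covers S → a ∈ base → ¬ Requirement S A a → Refuted A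
  refuted-if-unmet {a = var _} _ _ ¬r = contradiction tt ¬r
  refuted-if-unmet {a = ~ _}   _ _ ¬r = contradiction tt ¬r
  refuted-if-unmet {a = _ ⇒ _} _ _ ¬r = contradiction tt ¬r
  refuted-if-unmet {S} {A} {⊡ θ} cov m ¬r with val A ⊨? ⊡ θ
  ... | yes h = refute-reflexive ⊡-T (InBase-atom m) (InBase-atom m ∘′ there) h
                  (λ hθ → ¬r ((λ _ → hθ) , inj₁ h))
  ... | no ¬h = refute-stable ⊡-mono (InBase-δ A) ⊨δ δ-stable δ⇒θ (InBase-atom m) ¬h
    where
    δ⇒θ : ⊢ δ A ⇒ θ
    δ⇒θ = ⊢-by-cover cov (InBase-⇒ (δ A) θ (InBase-δ A) (InBase-atom m ∘′ there)) λ B∈S →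
      ⊨⇒-intro λ hδ → ⊨-stable λ ¬θ → ¬r ((λ h → contradiction h ¬h) , inj₂ (lose B∈S (⊨δ⇒Leq hδ , ¬θ)))
  refuted-if-unmet {S} {A} {□ θ} cov m ¬r with val A ⊨? □ θ
  ... | yes h = refute-reflexive truth (InBase-atom m) (InBase-atom m ∘′ there) h
                  (λ hθ → ¬r ((λ _ → hθ) , inj₁ h))
  ... | no ¬h = refute-stable □-mono (InBase-σ A) ⊨σ σ-stable σ⇒θ (InBase-atom m) ¬h
    where
    σ⇒θ : ⊢ σ A ⇒ θ
    σ⇒θ = ⊢-by-cover cov (InBase-⇒ (σ A) θ (InBase-σ A) (InBase-atom m ∘′ there)) λ B∈S →
      ⊨⇒-intro λ hσ → ⊨-stable λ ¬θ → ¬r ((λ h → contradiction h ¬h) , inj₂ (lose B∈S (⊨σ⇒Eqv hσ , ¬θ)))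

  refuted-if-not-viable : ∀ {S A} → Covers S → ¬ Viable S A → Refuted A
  refuted-if-not-viable {S} {A} cov ¬v =
    let _ , m , ¬r = find (¬All⇒Any¬ (requirement? S A) base ¬v) in refuted-if-unmet cov m ¬r

  prune : List Assignment → List Assignment
  prune S = filter (viable? S) S

  prune-covers : ∀ {S} → Covers S → Covers (prune S)
  prune-covers {S} cov {B} m with cov m
  ... | inj₂ r   = inj₂ r
  ... | inj₁ B∈S with viable? S B
  ...   | yes v = inj₁ (∈-filter⁺ (viable? S) B∈S v)
  ...   | no ¬v = inj₂ (refuted-if-not-viable cov ¬v)

  eliminate : ∀ n S → length S ≤ n → Covers S → Σ[ S′ ∈ List Assignment ] Covers S′ × All (Viable S′) S′
  eliminate n S len cov with all? (viable? S) S
  ... | yes v = S , cov , v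
  eliminate zero    []      _   _   | no ¬v = contradiction [] ¬v
  eliminate (suc n) S       len cov | no ¬v = eliminate n (prune S) shrinks (prune-covers cov)
    where
    shrinks : length (prune S) ≤ n
    shrinks = ℕ.≤-pred (ℕ.<-≤-trans (filter-notAll (viable? S) S (¬All⇒Any¬ (viable? S) S ¬v)) len)

  module Canonical (S : List Assignment) (viable : All (Viable S) S) where

    -- Each step is tagged with a piece of evidence; evidence e identifies two points whose steps
    -- tagged below e agree.
    Path : Set
    Path = List (ℕ × Assignment)

    data Chain : Assignment → Path → Set where
      []  : ∀ {A} → Chain A []
      _∷_ : ∀ {A B m t} → B ∈ S × Leq A B → Chain B t → Chain A ((m , B) ∷ t)

    last : Assignment → Path → Assignment
    last A []            = A
    last _ ((_ , B) ∷ t) = last B t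

    record Point : Set where
      constructor point
      field
        root   : Assignment
        root∈S : root ∈ S
        path   : Path
        chain  : Chain root path
    open Point

    world : Point → Assignment
    world p = last (root p) (path p)

    last∈S : ∀ {A t} → A ∈ S → Chain A t → last A t ∈ S
    last∈S A∈S []             = A∈S
    last∈S _   ((B∈S , _) ∷ c) = last∈S B∈S c

    requirement : ∀ p {a} → a ∈ base → Requirement S (world p) a
    requirement p m = All.lookup (All.lookup viable (last∈S (root∈S p) (chain p))) m

    Leq-last : ∀ {A t} → Chain A t → Leq A (last A t)
    Leq-last []             = Leq-refl
    Leq-last ((_ , l) ∷ c) = Leq-trans l (Leq-last c)

    _≈ᵖ_ : Path → Path → Set
    _≈ᵖ_ = Pointwise (×-Pointwise _≡_ Eqv)

    ≈ᵖ-isEquivalence : IsEquivalence _≈ᵖ_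
    ≈ᵖ-isEquivalence = Pointwise.isEquivalence (×-isEquivalence ≡.isEquivalence Eqv-isEquivalence)

    prefix : ℕ → Path → Path
    prefix e = takeWhileᵇ (λ (m , _) → m <ᵇ e)

    Rel : ℕ → Point → Point → Set
    Rel e = ×-Pointwise Eqv _≈ᵖ_ on λ p → root p , prefix e (path p)

    M : Model
    M = record
      { W     = Point
      ; E     = ℕ
      ; R     = Rel
      ; equiv = λ e → On.isEquivalence _ (×-isEquivalence Eqv-isEquivalence ≈ᵖ-isEquivalence)
      ; π     = λ k p → val (world p) ⊨ var k
      }

    maxLabel : Path → ℕ
    maxLabel t = max 0 (map proj₁ t)

    labels<maxLabel : ∀ t → All ((_< suc (maxLabel t)) ∘′ proj₁) t
    labels<maxLabel t = map⁻ (All.map s≤s (xs≤max 0 (map proj₁ t)))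

    prefix-all : ∀ e {t} → All ((_< e) ∘′ proj₁) t → prefix e t ≡ t
    prefix-all e {(m , _) ∷ _} (m<e ∷ ms) with m <ᵇ e | ℕ.<⇒<ᵇ m<e
    ... | true  | _  = cong (_ ∷_) (prefix-all e ms)
    ... | false | ()
    prefix-all _ [] = refl

    prefix-snoc : ∀ e {K B} t → e ≤ K → prefix e (t ++ [ (K , B) ]) ≡ prefix e t
    prefix-snoc e {K} [] e≤K with K <ᵇ e | ℕ.<ᵇ⇒< K e
    ... | true  | K<e = contradiction (K<e _) (ℕ.≤⇒≯ e≤K)
    ... | false | _   = refl
    prefix-snoc e ((m , _) ∷ t) e≤K with m <ᵇ e
    ... | true  = cong (_ ∷_) (prefix-snoc e t e≤K)
    ... | false = refl

    prefix-cong : ∀ e {t t′} → t ≈ᵖ t′ → prefix e t ≈ᵖ prefix e t′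
    prefix-cong _ [] = []
    prefix-cong e {(m , _) ∷ _} ((refl , eqv) ∷ pw) with m <ᵇ e
    ... | true  = (refl , eqv) ∷ prefix-cong e pw
    ... | false = []

    last-cong : ∀ {A A′ t t′} → Eqv A A′ → t ≈ᵖ t′ → Eqv (last A t) (last A′ t′)
    last-cong e []               = e
    last-cong _ ((_ , e′) ∷ pw) = last-cong e′ pw

    Leq-last-prefix : ∀ e {A A′ t u} → Eqv A A′ → t ≈ᵖ prefix e u → Chain A′ u →
                      Leq (last A t) (last A′ u)
    Leq-last-prefix _ {t = []} eqv _ c = Leq-trans (Eqv⇒Leq eqv) (Leq-last c)
    Leq-last-prefix e {t = _ ∷ _} {u = (m , _) ∷ _} eqv pw (_ ∷ c) with m <ᵇ e | pw
    ... | true | (refl , eqv′) ∷ pw′ = Leq-last-prefix e eqv′ pw′ c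

    forth-⊡ : ∀ p → Σ[ F ∈ List ℕ ] ∀ q → RF M F p q → Leq (world p) (world q)
    forth-⊡ p = [ k ] , λ q rf →
      let eqv , pw = rf k (here refl)
      in Leq-last-prefix k eqv (subst (_≈ᵖ prefix k (path q)) whole pw) (chain q)
      where
      k = suc (maxLabel (path p))
      whole : prefix k (path p) ≡ path p
      whole = prefix-all k (labels<maxLabel (path p))

    back-⊡ : ∀ p F {B} → B ∈ S → Leq (world p) B → Σ[ q ∈ Point ] RF M F p q × world q ≡ B
    back-⊡ (point A A∈S t c) F {B} B∈S l =
      point A A∈S (t ++ [ (K , B) ]) (snoc t c l)
      , (λ e e∈F → Eqv-refl , same-prefix e∈F)
      , last-snoc A t
      where
      K = max 0 F
      snoc : ∀ {A} t → Chain A t → Leq (last A t) B → Chain A (t ++ [ (K , B) ])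
      snoc []      []      l = (B∈S , l) ∷ []
      snoc (_ ∷ t) (x ∷ c) l = x ∷ snoc t c l
      last-snoc : ∀ A t → last A (t ++ [ (K , B) ]) ≡ B
      last-snoc A []            = refl
      last-snoc _ ((_ , C) ∷ t) = last-snoc C t
      same-prefix : ∀ {e} → e ∈ F → prefix e t ≈ᵖ prefix e (t ++ [ (K , B) ])
      same-prefix {e} e∈F = subst (prefix e t ≈ᵖ_) (sym (prefix-snoc e t (All.lookup (xs≤max 0 F) e∈F)))
                              (IsEquivalence.refl ≈ᵖ-isEquivalence)

    forth-□ : ∀ p q → RE M p q → Eqv (world p) (world q)
    forth-□ p q re =
      let eqv , pw = re k
          bounded = labels<maxLabel (path p ++ path q)
      in last-cong eqv (subst₂ _≈ᵖ_ (prefix-all k (++⁻ˡ (path p) bounded))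
                                    (prefix-all k (++⁻ʳ (path p) bounded)) pw)
      where
      k = suc (maxLabel (path p ++ path q))

    retarget : ∀ {A t B} → A ∈ S → Chain A t → B ∈ S → Eqv (last A t) B →
               Σ[ q ∈ Point ] Eqv A (root q) × t ≈ᵖ path q × world q ≡ B
    retarget _   []               B∈S eqv = point _ B∈S [] [] , eqv , [] , refl
    retarget A∈S ((C∈S , l) ∷ c) B∈S eqv =
      let q , eqv′ , pw , w = retarget C∈S c B∈S eqv
      in point _ A∈S (_ ∷ path q) ((root∈S q , Leq-trans l (Eqv⇒Leq eqv′)) ∷ chain q)
       , Eqv-refl , (refl , eqv′) ∷ pw , w

    back-□ : ∀ p {B} → B ∈ S → Eqv (world p) B → Σ[ q ∈ Point ] RE M p q × world q ≡ B
    back-□ p B∈S eqv =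
      let q , eqv′ , pw , w = retarget (root∈S p) (chain p) B∈S eqv
      in q , (λ e → eqv′ , prefix-cong e pw) , w

    infix 4 _⊩ᶜ_
    _⊩ᶜ_ : Point → Fm → Set
    _⊩ᶜ_ = _⊩_ M

    Truthful : Fm → Set
    Truthful ψ = ∀ p → p ⊩ᶜ ψ ⇔ val (world p) ⊨ ψ

    truthful-⊡ : ∀ {θ} → ⊡ θ ∈ base → Truthful θ → Truthful (⊡ θ)
    truthful-⊡ {θ} m ih p = mk⇔ ⊩⇒⊨ ⊨⇒⊩
      where
      ⊩⇒⊨ : p ⊩ᶜ ⊡ θ → val (world p) ⊨ ⊡ θ
      ⊩⇒⊨ (F , h) = ⊨-stable λ ¬h → case proj₂ (requirement p m) of λ where
        (inj₁ h′) → ¬h h′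
        (inj₂ w)  → let _ , B∈S , l , ¬θ = find w
                        q , rf , q↦B = back-⊡ p F B∈S l
                    in ¬θ (subst (λ C → val C ⊨ θ) q↦B (to (ih q) (h q rf)))
      ⊨⇒⊩ : val (world p) ⊨ ⊡ θ → p ⊩ᶜ ⊡ θ
      ⊨⇒⊩ h = let F , l = forth-⊡ p in
        F , λ q rf → from (ih q) (proj₁ (requirement q m) (All.lookup (l q rf) m (⊡ᵈ θ) h))

    truthful-□ : ∀ {θ} → □ θ ∈ base → Truthful θ → Truthful (□ θ)
    truthful-□ {θ} m ih p = mk⇔ ⊩⇒⊨ ⊨⇒⊩
      where
      ⊩⇒⊨ : p ⊩ᶜ □ θ → val (world p) ⊨ □ θ
      ⊩⇒⊨ h = ⊨-stable λ ¬h → case proj₂ (requirement p m) of λ where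
        (inj₁ h′) → ¬h h′
        (inj₂ w)  → let _ , B∈S , eqv , ¬θ = find w
                        q , re , q↦B = back-□ p B∈S eqv
                    in ¬θ (subst (λ C → val C ⊨ θ) q↦B (to (ih q) (h q re)))
      ⊨⇒⊩ : val (world p) ⊨ □ θ → p ⊩ᶜ □ θ
      ⊨⇒⊩ h q re = from (ih q) (proj₁ (requirement q m) (Eqv-⊨ (forth-□ p q re) m (□ᵐ θ) h))

    truth-lemma : ∀ ψ → InBase ψ → Truthful ψ
    truth-lemma (var k) _ p = mk⇔ id id
    truth-lemma (~ ψ)   i p = let ih = truth-lemma ψ i p in
      mk⇔ (λ ¬h → ⊨~-intro (¬h ∘′ from ih)) (λ h h′ → ⊨~-elim h (to ih h′))
    truth-lemma (ψ ⇒ φ) i p = mk⇔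
      [ (λ ¬hψ → ⊨⇒-intro (⊥-elim ∘′ ¬hψ ∘′ from ihψ)) , (λ hφ → ⊨⇒-intro λ _ → to ihφ hφ) ]′
      (λ h → case val (world p) ⊨? ψ of λ where
        (yes hψ) → inj₂ (from ihφ (⊨⇒-elim h hψ))
        (no ¬hψ) → inj₁ (¬hψ ∘′ to ihψ))
      where
      ihψ = truth-lemma ψ (i ∘′ ∈-++⁺ˡ) p
      ihφ = truth-lemma φ (i ∘′ ∈-++⁺ʳ (atoms ψ)) p
    truth-lemma (⊡ θ) i = truthful-⊡ (i (here refl)) (truth-lemma θ (i ∘′ there))
    truth-lemma (□ θ) i = truthful-□ (i (here refl)) (truth-lemma θ (i ∘′ there))

  completeness : Valid φ₀ → ⊢ φ₀
  completeness valid with eliminate (length allAssignments) allAssignments ℕ.≤-refl inj₁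
  ... | S , cov , viable = ⊢-by-cover cov id λ B∈S →
    to (truth-lemma φ₀ id (point _ B∈S [] [])) (valid M (point _ B∈S [] []))
    where open Canonical S viable

theorem2 : ∀ (φ₀ : Fm) → Valid φ₀ → ⊢ φ₀
theorem2 φ₀ = Completeness.completeness φ₀
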